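{- Let $\Lambda:=\{(a,b\sqrt3)\in\mathbb{R}^2: 2a,2b,a+b\in\mathbb{Z}\}$ (the lattice generated by the vertices $(0,0),(1,0),(\frac12,\frac{\sqrt3}2)$ of an equilateral triangle) and let \[T:=\operatorname{conv}\left(\left(-\tfrac47,\tfrac{2\sqrt3}7\right),\left(\tfrac{17}{14},\tfrac{9\sqrt3}{14}\right),\left(\tfrac67,-\tfrac{3\sqrt3}7\right)\right).\] Then $T$ is hollow with respect to $\Lambda$, its lattice width with respect to $\Lambda$ is $2+\frac17$, and $7T$ is a lattice triangle (its vertices lie in $\Lambda$).
   Context: A convex body is hollow with respect to $\Lambda$ if its interior contains no point of $\Lambda$. The lattice width of $K$ with respect to $\Lambda$ is $\inf_{f\in\Lambda^*\setminus\{0\}}$ of the length of $f(K)$, where $\Lambda^*$ is the dual lattice. -}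

module Defs where

open import Data.Nat using (ℕ)
open import Data.Integer using (ℤ; +_; -[1+_])
open import Data.Rational using (ℚ; _/_; _+_; _-_; _*_; _⊔_; _⊓_; _<_; _≤_; 0ℚ)
open import Data.Product using (_×_; _,_; Σ; ∃; ∃-syntax)
open import Relation.Binary.PropositionalEquality using (_≡_)
open import Relation.Nullary using (¬_)

-- Coordinates: the pair (a , b) : ℚ × ℚ stands for the point (a, b√3) ∈ ℝ².
-- All points of interest (lattice points, vertices of T) have this form with a,b rational.
Pt : Set
Pt = ℚ × ℚ

IsInt : ℚ → Set
IsInt q = ∃[ z ] q ≡ z / 1

two : ℚ
two = + 2 / 1

InΛ : Pt → Set
InΛ (a , b) = IsInt (two * a) × IsInt (two * b) × IsInt (a + b)

-- A real linear functional f on ℝ² is written f(x,y) = α x + γ y; in our coordinates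
-- f(a, b√3) = α a + β b with β = γ√3.  If f ∈ Λ* then α = f(1,0) ∈ ℤ and
-- β = 2 f(1/2, √3/2) - α ∈ ℤ, so α, β are rational (indeed integers): representing
-- functionals by pairs (α , β) of rationals loses no element of Λ*.
Fn : Set
Fn = ℚ × ℚ

ev : Fn → Pt → ℚ
ev (α , β) (a , b) = α * a + β * b

InΛ* : Fn → Set
InΛ* f = ∀ p → InΛ p → IsInt (ev f p)

NonzeroFn : Fn → Set
NonzeroFn (α , β) = ¬ (α ≡ 0ℚ × β ≡ 0ℚ)

Tri : Set
Tri = Pt × Pt × Pt

InInterior : Tri → Pt → Set
InInterior ((a₁ , b₁) , (a₂ , b₂) , (a₃ , b₃)) (a , b) =
  Σ ℚ λ l₁ → Σ ℚ λ l₂ → Σ ℚ λ l₃ →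
    (0ℚ < l₁) × (0ℚ < l₂) × (0ℚ < l₃) × (l₁ + l₂ + l₃ ≡ + 1 / 1) ×
    (a ≡ l₁ * a₁ + l₂ * a₂ + l₃ * a₃) × (b ≡ l₁ * b₁ + l₂ * b₂ + l₃ * b₃)

Hollow : Tri → Set
Hollow T = ∀ p → InΛ p → ¬ InInterior T p

lengthImage : Fn → Tri → ℚ
lengthImage f (v₁ , v₂ , v₃) =
  (ev f v₁ ⊔ ev f v₂ ⊔ ev f v₃) - (ev f v₁ ⊓ ev f v₂ ⊓ ev f v₃)

IsLatticeWidth : Tri → ℚ → Set
IsLatticeWidth T w =
  (∀ f → InΛ* f → NonzeroFn f → w ≤ lengthImage f T) ×
  (∀ ε → 0ℚ < ε → ∃[ f ] (InΛ* f × NonzeroFn f × lengthImage f T < w + ε))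

scaleTri : ℚ → Tri → Tri
scaleTri c ((a₁ , b₁) , (a₂ , b₂) , (a₃ , b₃)) =
  ((c * a₁ , c * b₁) , (c * a₂ , c * b₂) , (c * a₃ , c * b₃))

LatticeTri : Tri → Set
LatticeTri (v₁ , v₂ , v₃) = InΛ v₁ × InΛ v₂ × InΛ v₃

T : Tri
T = ((-[1+ 3 ] / 7 , + 2 / 7) , (+ 17 / 14 , + 9 / 14) , (+ 6 / 7 , -[1+ 2 ] / 7))

-- In the coordinates (a + b, a − b) the lattice Λ becomes ℤ² and Λ* becomes the
-- functionals with integer coordinates s = f(½,½), t = f(½,−½); the vertices of
-- 7T become (−2,−6), (13,4), (3,9).
-- Hollowness: the three edge functionals of T are positive on its interior and
-- are integer affine forms 3 − m − 2n, 3m − n, 2 − 2m + 3n in lattice coordinates;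
-- two positive combinations give 2 + 7m > 0 and 13 − 7m > 0, so m ∈ {0, 1}, and
-- both cases are infeasible.
-- Width: 7f takes the values −2s − 6t, 13s + 4t, 3s + 9t on the vertices, whose
-- gaps 5(3s + 2t), 5(2s − t), 5(s + 3t) cannot all be smaller than 15 in absolute
-- value unless s = t = 0; the functional a + b attains 15/7.
module Submission where

open import Defs
open import Data.Integer using (+_)
open import Data.Rational using (_/_)
open import Data.Product using (_×_)

open import Data.Nat as ℕ using (suc; z≤n; s≤s)
import Data.Nat.Properties as ℕₚ
open import Data.Integer as ℤ using (ℤ; -[1+_]; +<+; +≤+)
import Data.Integer.Properties as ℤₚ
import Data.Integer.Solver as ℤ-Solver
open import Data.Rational
  using (ℚ; mkℚ; _+_; _-_; _*_; -_; ∣_∣; _<_; _≤_; _⊔_; _⊓_; 0ℚ; 1ℚ; NonNegative; positive; nonNegative; *≤*)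
open import Data.Rational.Properties
import Data.Rational.Solver as ℚ-Solver
import Data.Nat.Coprimality as Coprimality
open import Data.Product using (_,_; proj₁; proj₂; ∃-syntax)
open import Data.Sum using (_⊎_; inj₁; inj₂)
open import Data.Empty using (⊥; ⊥-elim)
open import Relation.Nullary using (¬_)
open import Relation.Binary.PropositionalEquality

module ℚS = ℚ-Solver.+-*-Solver
module ℤS = ℤ-Solver.+-*-Solver

-- Unlike z / 1, which normalises through gcd, this computes on a variable z.
ι : ℤ → ℚ
ι z = mkℚ z 0 (Coprimality.sym (Coprimality.1-coprimeTo _))

/1≡ι : ∀ z → z / 1 ≡ ι z
/1≡ι z = ↥p/↧p≡p (ι z)

IsInt⇒ι : ∀ {q} → IsInt q → ∃[ z ] q ≡ ι z
IsInt⇒ι (z , q≡z/1) = z , trans q≡z/1 (/1≡ι z)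

ι-+ : ∀ x y → ι x + ι y ≡ ι (x ℤ.+ y)
ι-+ x y = trans (cong (_/ 1) (cong₂ ℤ._+_ (ℤₚ.*-identityʳ x) (ℤₚ.*-identityʳ y))) (/1≡ι _)

ι-* : ∀ x y → ι x * ι y ≡ ι (x ℤ.* y)
ι-* x y = /1≡ι _

ι-neg : ∀ x → - ι x ≡ ι (ℤ.- x)
ι-neg (+ 0)     = refl
ι-neg (+ suc n) = refl
ι-neg -[1+ n ]  = refl

ι-lin : ∀ x c y d → ι x * ι c + ι y * ι d ≡ ι (x ℤ.* c ℤ.+ y ℤ.* d)
ι-lin x c y d = trans (cong₂ _+_ (ι-* x c) (ι-* y d)) (ι-+ (x ℤ.* c) (y ℤ.* d))

ι-mono-≤ : ∀ {j k} → j ℤ.≤ k → ι j ≤ ι k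
ι-mono-≤ {j} {k} j≤k = *≤* (subst₂ ℤ._≤_ (sym (ℤₚ.*-identityʳ j)) (sym (ℤₚ.*-identityʳ k)) j≤k)

0<ι⇒0< : ∀ {k} → 0ℚ < ι k → ℤ.0ℤ ℤ.< k
0<ι⇒0< {k} 0<k = subst (ℤ.0ℤ ℤ.<_) (ℤₚ.*-identityʳ k) (drop-*<* 0<k)

½ : ℚ
½ = + 1 / 2

e₊ e₋ : Pt
e₊ = (½ , ½)
e₋ = (½ , - ½)

e₊∈Λ : InΛ e₊
e₊∈Λ = (+ 1 , refl) , (+ 1 , refl) , (+ 1 , refl)

e₋∈Λ : InΛ e₋
e₋∈Λ = (+ 1 , refl) , (-[1+ 0 ] , refl) , (+ 0 , refl)

coord₊ coord₋ : Pt → ℚ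
coord₊ (a , b) = a + b
coord₋ (a , b) = a - b

ev-coords : ∀ f p → ev f p ≡ coord₊ p * ev f e₊ + coord₋ p * ev f e₋
ev-coords (α , β) (a , b) = solve 4
  (λ α β a b → α :* a :+ β :* b
    := (a :+ b) :* (α :* con ½ :+ β :* con ½) :+ (a :- b) :* (α :* con ½ :+ β :* con (- ½)))
  refl α β a b
  where open ℚS

InΛ⇒coords : ∀ {p} → InΛ p → ∃[ m ] ∃[ n ] (coord₊ p ≡ ι m × coord₋ p ≡ ι n)
InΛ⇒coords {a , b} (2a∈ℤ , _ , a+b∈ℤ) with IsInt⇒ι 2a∈ℤ | IsInt⇒ι a+b∈ℤ
... | k , 2a≡k | m , a+b≡m = m , k ℤ.- m , a+b≡m , a-b≡k-m
  where
  open ≡-Reasoning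
  a-b≡k-m : a - b ≡ ι (k ℤ.- m)
  a-b≡k-m = begin
    a - b              ≡⟨ ℚS.solve 2 (λ a b → a ℚS.:- b ℚS.:= ℚS.con two ℚS.:* a ℚS.:- (a ℚS.:+ b)) refl a b ⟩
    two * a - (a + b)  ≡⟨ cong₂ _-_ 2a≡k a+b≡m ⟩
    ι k - ι m          ≡⟨ cong (_+_ (ι k)) (ι-neg m) ⟩
    ι k + ι (ℤ.- m)    ≡⟨ ι-+ k (ℤ.- m) ⟩
    ι (k ℤ.- m)        ∎

dual-coords-zero : ∀ α β → ev (α , β) e₊ ≡ 0ℚ → ev (α , β) e₋ ≡ 0ℚ → α ≡ 0ℚ × β ≡ 0ℚ
dual-coords-zero α β f₊≡0 f₋≡0 =
  trans (solve 2 (λ α β → α := (α :* con ½ :+ β :* con ½) :+ (α :* con ½ :+ β :* con (- ½))) refl α β)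
        (cong₂ _+_ f₊≡0 f₋≡0) ,
  trans (solve 2 (λ α β → β := (α :* con ½ :+ β :* con ½) :- (α :* con ½ :+ β :* con (- ½))) refl α β)
        (cong₂ _-_ f₊≡0 f₋≡0)
  where open ℚS

Affine : Set
Affine = ℚ × Fn

eval : Affine → Pt → ℚ
eval (c , f) p = c + ev f p

infixl 6 _⊕_
infixr 7 _·_

_⊕_ : Pt → Pt → Pt
(a , b) ⊕ (a′ , b′) = (a + a′ , b + b′)

_·_ : ℚ → Pt → Pt
l · (a , b) = (l * a , l * b)

ev-⊕ : ∀ f p q → ev f (p ⊕ q) ≡ ev f p + ev f q
ev-⊕ (α , β) (a , b) (a′ , b′) = solve 6
  (λ α β a b a′ b′ → α :* (a :+ a′) :+ β :* (b :+ b′) := (α :* a :+ β :* b) :+ (α :* a′ :+ β :* b′))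
  refl α β a b a′ b′
  where open ℚS

ev-· : ∀ f l p → ev f (l · p) ≡ l * ev f p
ev-· (α , β) l (a , b) = solve 5
  (λ α β l a b → α :* (l :* a) :+ β :* (l :* b) := l :* (α :* a :+ β :* b)) refl α β l a b
  where open ℚS

affine-combination : ∀ g v₁ v₂ v₃ {l₁ l₂ l₃} → l₁ + l₂ + l₃ ≡ 1ℚ →
  eval g (l₁ · v₁ ⊕ l₂ · v₂ ⊕ l₃ · v₃) ≡ l₁ * eval g v₁ + l₂ * eval g v₂ + l₃ * eval g v₃
affine-combination (c , f) v₁ v₂ v₃ {l₁} {l₂} {l₃} Σl≡1 = begin
  c + ev f (l₁ · v₁ ⊕ l₂ · v₂ ⊕ l₃ · v₃)
    ≡⟨ cong (_+_ c) ev-linear ⟩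
  c + (l₁ * x₁ + l₂ * x₂ + l₃ * x₃)
    ≡⟨ cong (_+ (l₁ * x₁ + l₂ * x₂ + l₃ * x₃)) (sym (trans (cong (_* c) Σl≡1) (*-identityˡ c))) ⟩
  (l₁ + l₂ + l₃) * c + (l₁ * x₁ + l₂ * x₂ + l₃ * x₃)
    ≡⟨ ℚS.solve 7 (λ c l₁ l₂ l₃ x₁ x₂ x₃ →
          (l₁ ℚS.:+ l₂ ℚS.:+ l₃) ℚS.:* c ℚS.:+ (l₁ ℚS.:* x₁ ℚS.:+ l₂ ℚS.:* x₂ ℚS.:+ l₃ ℚS.:* x₃)
          ℚS.:= l₁ ℚS.:* (c ℚS.:+ x₁) ℚS.:+ l₂ ℚS.:* (c ℚS.:+ x₂) ℚS.:+ l₃ ℚS.:* (c ℚS.:+ x₃))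
        refl c l₁ l₂ l₃ x₁ x₂ x₃ ⟩
  l₁ * (c + x₁) + l₂ * (c + x₂) + l₃ * (c + x₃) ∎
  where
  open ≡-Reasoning
  x₁ = ev f v₁
  x₂ = ev f v₂
  x₃ = ev f v₃
  ev-linear : ev f (l₁ · v₁ ⊕ l₂ · v₂ ⊕ l₃ · v₃) ≡ l₁ * x₁ + l₂ * x₂ + l₃ * x₃
  ev-linear = trans (ev-⊕ f _ _)
    (cong₂ _+_ (trans (ev-⊕ f _ _) (cong₂ _+_ (ev-· f l₁ v₁) (ev-· f l₂ v₂))) (ev-· f l₃ v₃))

pos*pos : ∀ {p q} → 0ℚ < p → 0ℚ < q → 0ℚ < p * q
pos*pos {p} {q} p>0 q>0 = positive⁻¹ (p * q) {{pos*pos⇒pos p {{positive p>0}} q {{positive q>0}}}}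

pos*nonNeg : ∀ {p q} → 0ℚ < p → 0ℚ ≤ q → 0ℚ ≤ p * q
pos*nonNeg {p} {q} p>0 q≥0 =
  nonNegative⁻¹ (p * q) {{nonNeg*nonNeg⇒nonNeg p {{pos⇒nonNeg p {{positive p>0}}}} q {{nonNegative q≥0}}}}

positive-weighted-sum : ∀ {l₁ l₂ l₃ x₁ x₂ x₃} → 0ℚ < l₁ → 0ℚ < l₂ → 0ℚ < l₃ →
  0ℚ ≤ x₁ → 0ℚ ≤ x₂ → 0ℚ ≤ x₃ → 0ℚ < x₁ ⊎ 0ℚ < x₂ ⊎ 0ℚ < x₃ →
  0ℚ < l₁ * x₁ + l₂ * x₂ + l₃ * x₃
positive-weighted-sum l₁>0 l₂>0 l₃>0 x₁≥0 x₂≥0 x₃≥0 (inj₁ x₁>0) =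
  +-mono-<-≤ (+-mono-<-≤ (pos*pos l₁>0 x₁>0) (pos*nonNeg l₂>0 x₂≥0)) (pos*nonNeg l₃>0 x₃≥0)
positive-weighted-sum l₁>0 l₂>0 l₃>0 x₁≥0 x₂≥0 x₃≥0 (inj₂ (inj₁ x₂>0)) =
  +-mono-<-≤ (+-mono-≤-< (pos*nonNeg l₁>0 x₁≥0) (pos*pos l₂>0 x₂>0)) (pos*nonNeg l₃>0 x₃≥0)
positive-weighted-sum l₁>0 l₂>0 l₃>0 x₁≥0 x₂≥0 x₃≥0 (inj₂ (inj₂ x₃>0)) =
  +-mono-≤-< (+-mono-≤ (pos*nonNeg l₁>0 x₁≥0) (pos*nonNeg l₂>0 x₂≥0)) (pos*pos l₃>0 x₃>0)

positive-inside : ∀ g v₁ v₂ v₃ {p} →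
  0ℚ ≤ eval g v₁ → 0ℚ ≤ eval g v₂ → 0ℚ ≤ eval g v₃ → 0ℚ < eval g v₁ ⊎ 0ℚ < eval g v₂ ⊎ 0ℚ < eval g v₃ →
  InInterior (v₁ , v₂ , v₃) p → 0ℚ < eval g p
positive-inside g v₁@(a₁ , b₁) v₂@(a₂ , b₂) v₃@(a₃ , b₃) {a , b} g₁≥0 g₂≥0 g₃≥0 some-g>0
                (l₁ , l₂ , l₃ , l₁>0 , l₂>0 , l₃>0 , Σl≡1 , a≡ , b≡) =
  subst (0ℚ <_) (sym g[p]≡Σ) (positive-weighted-sum l₁>0 l₂>0 l₃>0 g₁≥0 g₂≥0 g₃≥0 some-g>0)
  where
  g[p]≡Σ : eval g (a , b) ≡ l₁ * eval g v₁ + l₂ * eval g v₂ + l₃ * eval g v₃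
  g[p]≡Σ = trans (cong (eval g) (cong₂ _,_ a≡ b≡)) (affine-combination g v₁ v₂ v₃ {l₁} {l₂} {l₃} Σl≡1)

v₁ v₂ v₃ : Pt
v₁ = proj₁ T
v₂ = proj₁ (proj₂ T)
v₃ = proj₂ (proj₂ T)

-- edgeᵢ vanishes on the side of T opposite vᵢ and equals 5 at vᵢ.
edge₁ edge₂ edge₃ : Affine
edge₁ = (ι (+ 3) , (ι -[1+ 2 ] , ι (+ 1)))
edge₂ = (ι (+ 0) , (ι (+ 2) , ι (+ 4)))
edge₃ = (ι (+ 2) , (ι (+ 1) , ι -[1+ 4 ]))

edges-positive-inside : ∀ {p} → InInterior T p → 0ℚ < eval edge₁ p × 0ℚ < eval edge₂ p × 0ℚ < eval edge₃ p
edges-positive-inside p∈T° =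
  positive-inside edge₁ v₁ v₂ v₃ (nonNegative⁻¹ _) (nonNegative⁻¹ _) (nonNegative⁻¹ _) (inj₁ (positive⁻¹ _)) p∈T° ,
  positive-inside edge₂ v₁ v₂ v₃ (nonNegative⁻¹ _) (nonNegative⁻¹ _) (nonNegative⁻¹ _) (inj₂ (inj₁ (positive⁻¹ _))) p∈T° ,
  positive-inside edge₃ v₁ v₂ v₃ (nonNegative⁻¹ _) (nonNegative⁻¹ _) (nonNegative⁻¹ _) (inj₂ (inj₂ (positive⁻¹ _))) p∈T°

eval-at-lattice-point : ∀ c f x y {p m n} → ev f e₊ ≡ ι x → ev f e₋ ≡ ι y →
  coord₊ p ≡ ι m → coord₋ p ≡ ι n → eval (ι c , f) p ≡ ι (c ℤ.+ (m ℤ.* x ℤ.+ n ℤ.* y))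
eval-at-lattice-point c f x y {p} {m} {n} f₊≡x f₋≡y p₊≡m p₋≡n = begin
  ι c + ev f p
    ≡⟨ cong (_+_ (ι c)) (ev-coords f p) ⟩
  ι c + (coord₊ p * ev f e₊ + coord₋ p * ev f e₋)
    ≡⟨ cong (_+_ (ι c)) (cong₂ _+_ (cong₂ _*_ p₊≡m f₊≡x) (cong₂ _*_ p₋≡n f₋≡y)) ⟩
  ι c + (ι m * ι x + ι n * ι y)
    ≡⟨ cong (_+_ (ι c)) (ι-lin m x n y) ⟩
  ι c + ι (m ℤ.* x ℤ.+ n ℤ.* y)
    ≡⟨ ι-+ c _ ⟩
  ι (c ℤ.+ (m ℤ.* x ℤ.+ n ℤ.* y)) ∎
  where open ≡-Reasoning

positive-combination : ∀ a b .{{_ : ℤ.Positive a}} .{{_ : ℤ.Positive b}} {x y} →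
  ℤ.0ℤ ℤ.< x → ℤ.0ℤ ℤ.< y → ℤ.0ℤ ℤ.< a ℤ.* x ℤ.+ b ℤ.* y
positive-combination a b x>0 y>0 = ℤₚ.+-mono-< (scale a x>0) (scale b y>0)
  where
  scale : ∀ c .{{_ : ℤ.Positive c}} {z} → ℤ.0ℤ ℤ.< z → ℤ.0ℤ ℤ.< c ℤ.* z
  scale c z>0 = subst (ℤ._< c ℤ.* _) (ℤₚ.*-zeroʳ c) (ℤₚ.*-monoˡ-<-pos c z>0)

no-solution-with-0≤m≤1 : ∀ m n →
  ℤ.0ℤ ℤ.< + 2 ℤ.+ m ℤ.* + 7 → ℤ.0ℤ ℤ.< + 13 ℤ.+ m ℤ.* -[1+ 6 ] →
  ℤ.0ℤ ℤ.< + 3 ℤ.+ (m ℤ.* -[1+ 0 ] ℤ.+ n ℤ.* -[1+ 1 ]) →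
  ℤ.0ℤ ℤ.< + 0 ℤ.+ (m ℤ.* + 3 ℤ.+ n ℤ.* -[1+ 0 ]) →
  ℤ.0ℤ ℤ.< + 2 ℤ.+ (m ℤ.* -[1+ 1 ] ℤ.+ n ℤ.* + 3) → ⊥
no-solution-with-0≤m≤1 -[1+ k ]         n                 ()   _    _          _          _
no-solution-with-0≤m≤1 (+ 0)            (+ 0)             _    _    _          (+<+ ())   _
no-solution-with-0≤m≤1 (+ 0)            (+ suc j)         _    _    _          ()         _
no-solution-with-0≤m≤1 (+ 0)            -[1+ j ]          _    _    _          _          ()
no-solution-with-0≤m≤1 (+ 1)            -[1+ j ]          _    _    _          _          ()
no-solution-with-0≤m≤1 (+ 1)            (+ 0)             _    _    _          _          (+<+ ())
no-solution-with-0≤m≤1 (+ 1)            (+ 1)             _    _    (+<+ ())   _          _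
no-solution-with-0≤m≤1 (+ 1)            (+ suc (suc j))   _    _    ()         _          _
no-solution-with-0≤m≤1 (+ suc (suc k))  n                 _    ()   _          _          _

edge-forms-not-all-positive : ∀ m n →
  ℤ.0ℤ ℤ.< + 3 ℤ.+ (m ℤ.* -[1+ 0 ] ℤ.+ n ℤ.* -[1+ 1 ]) →
  ℤ.0ℤ ℤ.< + 0 ℤ.+ (m ℤ.* + 3 ℤ.+ n ℤ.* -[1+ 0 ]) →
  ℤ.0ℤ ℤ.< + 2 ℤ.+ (m ℤ.* -[1+ 1 ] ℤ.+ n ℤ.* + 3) → ⊥
edge-forms-not-all-positive m n g₁>0 g₂>0 g₃>0 =
  no-solution-with-0≤m≤1 m n (subst (ℤ.0ℤ ℤ.<_) lower (positive-combination (+ 3) (+ 1) g₂>0 g₃>0))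
                             (subst (ℤ.0ℤ ℤ.<_) upper (positive-combination (+ 3) (+ 2) g₁>0 g₃>0))
                             g₁>0 g₂>0 g₃>0
  where
  open ℤS
  lower : + 3 ℤ.* (+ 0 ℤ.+ (m ℤ.* + 3 ℤ.+ n ℤ.* -[1+ 0 ])) ℤ.+ + 1 ℤ.* (+ 2 ℤ.+ (m ℤ.* -[1+ 1 ] ℤ.+ n ℤ.* + 3))
          ≡ + 2 ℤ.+ m ℤ.* + 7
  lower = solve 2 (λ m n → con (+ 3) :* (con (+ 0) :+ (m :* con (+ 3) :+ n :* con -[1+ 0 ]))
                             :+ con (+ 1) :* (con (+ 2) :+ (m :* con -[1+ 1 ] :+ n :* con (+ 3)))
                             := con (+ 2) :+ m :* con (+ 7)) refl m n
  upper : + 3 ℤ.* (+ 3 ℤ.+ (m ℤ.* -[1+ 0 ] ℤ.+ n ℤ.* -[1+ 1 ])) ℤ.+ + 2 ℤ.* (+ 2 ℤ.+ (m ℤ.* -[1+ 1 ] ℤ.+ n ℤ.* + 3))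
          ≡ + 13 ℤ.+ m ℤ.* -[1+ 6 ]
  upper = solve 2 (λ m n → con (+ 3) :* (con (+ 3) :+ (m :* con -[1+ 0 ] :+ n :* con -[1+ 1 ]))
                             :+ con (+ 2) :* (con (+ 2) :+ (m :* con -[1+ 1 ] :+ n :* con (+ 3)))
                             := con (+ 13) :+ m :* con -[1+ 6 ]) refl m n

hollow : Hollow T
hollow p@(a , b) p∈Λ p∈T° =
  let (m , n , p₊≡m , p₋≡n) = InΛ⇒coords {p} p∈Λ
      (g₁>0 , g₂>0 , g₃>0) = edges-positive-inside p∈T°
      integral : ∀ c x y f → ev f e₊ ≡ ι x → ev f e₋ ≡ ι y → 0ℚ < eval (ι c , f) p →
                 ℤ.0ℤ ℤ.< c ℤ.+ (m ℤ.* x ℤ.+ n ℤ.* y)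
      integral c x y f f₊≡x f₋≡y g>0 =
        0<ι⇒0< (subst (0ℚ <_) (eval-at-lattice-point c f x y f₊≡x f₋≡y p₊≡m p₋≡n) g>0)
  in edge-forms-not-all-positive m n
       (integral (+ 3) -[1+ 0 ] -[1+ 1 ] (proj₂ edge₁) refl refl g₁>0)
       (integral (+ 0) (+ 3) -[1+ 0 ] (proj₂ edge₂) refl refl g₂>0)
       (integral (+ 2) -[1+ 1 ] (+ 3) (proj₂ edge₃) refl refl g₃>0)

InRange : ℚ → ℚ → ℚ → Set
InRange lo hi x = lo ≤ x × x ≤ hi

∣-∣≤range : ∀ {lo hi x y} → InRange lo hi x → InRange lo hi y → ∣ x - y ∣ ≤ hi - lo
∣-∣≤range {lo} {hi} {x} {y} (lo≤x , x≤hi) (lo≤y , y≤hi) with ∣p∣≡p∨∣p∣≡-p (x - y)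
... | inj₁ ∣x-y∣≡x-y = subst (_≤ hi - lo) (sym ∣x-y∣≡x-y) (+-mono-≤ x≤hi (neg-antimono-≤ lo≤y))
... | inj₂ ∣x-y∣≡y-x = subst (_≤ hi - lo) (sym (trans ∣x-y∣≡y-x -[x-y]≡y-x)) (+-mono-≤ y≤hi (neg-antimono-≤ lo≤x))
  where
  open ℚS
  -[x-y]≡y-x : - (x - y) ≡ y - x
  -[x-y]≡y-x = solve 2 (λ x y → :- (x :- y) := y :- x) refl x y

in-range₁ : ∀ x₁ x₂ x₃ → InRange (x₁ ⊓ x₂ ⊓ x₃) (x₁ ⊔ x₂ ⊔ x₃) x₁
in-range₁ x₁ x₂ x₃ = ≤-trans (p⊓q≤p (x₁ ⊓ x₂) x₃) (p⊓q≤p x₁ x₂) , ≤-trans (p≤p⊔q x₁ x₂) (p≤p⊔q (x₁ ⊔ x₂) x₃)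

in-range₂ : ∀ x₁ x₂ x₃ → InRange (x₁ ⊓ x₂ ⊓ x₃) (x₁ ⊔ x₂ ⊔ x₃) x₂
in-range₂ x₁ x₂ x₃ = ≤-trans (p⊓q≤p (x₁ ⊓ x₂) x₃) (p⊓q≤q x₁ x₂) , ≤-trans (p≤q⊔p x₁ x₂) (p≤p⊔q (x₁ ⊔ x₂) x₃)

in-range₃ : ∀ x₁ x₂ x₃ → InRange (x₁ ⊓ x₂ ⊓ x₃) (x₁ ⊔ x₂ ⊔ x₃) x₃
in-range₃ x₁ x₂ x₃ = p⊓q≤q (x₁ ⊓ x₂) x₃ , p≤q⊔p (x₁ ⊔ x₂) x₃

≤∣*ι∣ : ∀ k .{{_ : NonNegative k}} {n} d → n ℕ.≤ ℤ.∣ d ∣ → k * ι (+ n) ≤ ∣ k * ι d ∣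
≤∣*ι∣ k {n} d n≤∣d∣ = begin
  k * ι (+ n)      ≤⟨ *-monoˡ-≤-nonNeg k (ι-mono-≤ (+≤+ n≤∣d∣)) ⟩
  k * ∣ ι d ∣      ≡⟨ cong (_* ∣ ι d ∣) (sym (0≤p⇒∣p∣≡p (nonNegative⁻¹ k))) ⟩
  ∣ k ∣ * ∣ ι d ∣  ≡⟨ sym (∣p*q∣≡∣p∣*∣q∣ k (ι d)) ⟩
  ∣ k * ι d ∣      ∎
  where open ≤-Reasoning

linear-gap : ∀ {A₁ B₁ A₂ B₂} k c d x y → A₂ - A₁ ≡ k * ι c → B₂ - B₁ ≡ k * ι d →
  (A₂ * ι x + B₂ * ι y) - (A₁ * ι x + B₁ * ι y) ≡ k * ι (x ℤ.* c ℤ.+ y ℤ.* d)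
linear-gap {A₁} {B₁} {A₂} {B₂} k c d x y ΔA ΔB = begin
  (A₂ * ι x + B₂ * ι y) - (A₁ * ι x + B₁ * ι y)
    ≡⟨ solve 6 (λ A₁ B₁ A₂ B₂ X Y → (A₂ :* X :+ B₂ :* Y) :- (A₁ :* X :+ B₁ :* Y)
                  := (A₂ :- A₁) :* X :+ (B₂ :- B₁) :* Y) refl A₁ B₁ A₂ B₂ (ι x) (ι y) ⟩
  (A₂ - A₁) * ι x + (B₂ - B₁) * ι y
    ≡⟨ cong₂ (λ u v → u * ι x + v * ι y) ΔA ΔB ⟩
  k * ι c * ι x + k * ι d * ι y
    ≡⟨ solve 5 (λ k C D X Y → k :* C :* X :+ k :* D :* Y := k :* (X :* C :+ Y :* D)) refl k (ι c) (ι d) (ι x) (ι y) ⟩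
  k * (ι x * ι c + ι y * ι d)
    ≡⟨ cong (k *_) (ι-lin x c y d) ⟩
  k * ι (x ℤ.* c ℤ.+ y ℤ.* d) ∎
  where
  open ≡-Reasoning
  open ℚS using (solve; _:=_; _:+_; _:-_; _:*_)

LargeGap : ℤ → ℤ → Set
LargeGap s t =
  3 ℕ.≤ ℤ.∣ s ℤ.* + 3 ℤ.+ t ℤ.* + 2 ∣ ⊎ 3 ℕ.≤ ℤ.∣ s ℤ.* + 2 ℤ.+ t ℤ.* -[1+ 0 ] ∣ ⊎ 3 ℕ.≤ ℤ.∣ s ℤ.* + 1 ℤ.+ t ℤ.* + 3 ∣

large-gap : ∀ s t → ¬ (s ≡ + 0 × t ≡ + 0) → LargeGap s t
large-gap (+ 0)      (+ 0)      st≢0 = ⊥-elim (st≢0 (refl , refl))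
large-gap (+ suc m)  (+ 0)      _    = inj₁ (s≤s (s≤s (s≤s z≤n)))
large-gap (+ suc m)  (+ suc n)  _    = inj₁ (s≤s (s≤s (s≤s z≤n)))
large-gap -[1+ m ]   (+ 0)      _    = inj₁ (s≤s (s≤s (s≤s z≤n)))
large-gap -[1+ m ]   -[1+ n ]   _    = inj₁ (s≤s (s≤s (s≤s z≤n)))
large-gap (+ suc m)  -[1+ n ]   _    = inj₂ (inj₁ (s≤s (s≤s (ℕₚ.≤-trans (s≤s z≤n) (ℕₚ.m≤n+m _ (m ℕ.* 2))))))
large-gap -[1+ m ]   (+ suc n)  _    = inj₂ (inj₁ (s≤s (s≤s (s≤s z≤n))))
large-gap (+ 0)      (+ suc n)  _    = inj₂ (inj₂ (s≤s (s≤s (s≤s z≤n))))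
large-gap (+ 0)      -[1+ n ]   _    = inj₂ (inj₂ (s≤s (s≤s (s≤s z≤n))))

module _ (f : Fn) {s t : ℤ} (f₊≡s : ev f e₊ ≡ ι s) (f₋≡t : ev f e₋ ≡ ι t) where

  private
    x₁ x₂ x₃ : ℚ
    x₁ = ev f v₁
    x₂ = ev f v₂
    x₃ = ev f v₃

    ev-in-coords : ∀ p → ev f p ≡ coord₊ p * ι s + coord₋ p * ι t
    ev-in-coords p = trans (ev-coords f p) (cong₂ (λ u v → coord₊ p * u + coord₋ p * v) f₊≡s f₋≡t)

    width-from-gap : ∀ {lo hi} u v c d →
      coord₊ u - coord₊ v ≡ + 5 / 7 * ι c → coord₋ u - coord₋ v ≡ + 5 / 7 * ι d →
      3 ℕ.≤ ℤ.∣ s ℤ.* c ℤ.+ t ℤ.* d ∣ → InRange lo hi (ev f u) → InRange lo hi (ev f v) → + 15 / 7 ≤ hi - lo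
    width-from-gap u v c d Δ₊ Δ₋ 3≤∣d∣ u∈ v∈ = ≤-trans (≤∣*ι∣ (+ 5 / 7) (s ℤ.* c ℤ.+ t ℤ.* d) 3≤∣d∣)
      (subst (λ z → ∣ z ∣ ≤ _) fu-fv≡ (∣-∣≤range u∈ v∈))
      where
      fu-fv≡ : ev f u - ev f v ≡ + 5 / 7 * ι (s ℤ.* c ℤ.+ t ℤ.* d)
      fu-fv≡ = trans (cong₂ _-_ (ev-in-coords u) (ev-in-coords v))
                     (linear-gap {coord₊ v} {coord₋ v} {coord₊ u} {coord₋ u} (+ 5 / 7) c d s t Δ₊ Δ₋)

  lengthImage≥15/7 : LargeGap s t → + 15 / 7 ≤ lengthImage f T
  lengthImage≥15/7 (inj₁ h)        = width-from-gap v₂ v₁ (+ 3) (+ 2) refl refl h (in-range₂ x₁ x₂ x₃) (in-range₁ x₁ x₂ x₃)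
  lengthImage≥15/7 (inj₂ (inj₁ h)) = width-from-gap v₂ v₃ (+ 2) -[1+ 0 ] refl refl h (in-range₂ x₁ x₂ x₃) (in-range₃ x₁ x₂ x₃)
  lengthImage≥15/7 (inj₂ (inj₂ h)) = width-from-gap v₃ v₁ (+ 1) (+ 3) refl refl h (in-range₃ x₁ x₂ x₃) (in-range₁ x₁ x₂ x₃)

width-lower-bound : ∀ f → InΛ* f → NonzeroFn f → + 15 / 7 ≤ lengthImage f T
width-lower-bound f@(α , β) f∈Λ* f≢0 =
  let (s , f₊≡s) = IsInt⇒ι (f∈Λ* e₊ e₊∈Λ)
      (t , f₋≡t) = IsInt⇒ι (f∈Λ* e₋ e₋∈Λ)
  in lengthImage≥15/7 f f₊≡s f₋≡t (large-gap s t λ (s≡0 , t≡0) →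
       f≢0 (dual-coords-zero α β (trans f₊≡s (cong ι s≡0)) (trans f₋≡t (cong ι t≡0))))

a+b∈Λ* : InΛ* (1ℚ , 1ℚ)
a+b∈Λ* (a , b) (_ , _ , a+b∈ℤ) = subst IsInt (sym (cong₂ _+_ (*-identityˡ a) (*-identityˡ b))) a+b∈ℤ

width-attained : ∀ ε → 0ℚ < ε → ∃[ f ] (InΛ* f × NonzeroFn f × lengthImage f T < + 15 / 7 + ε)
-- lengthImage (1ℚ , 1ℚ) T computes to 15/7: a + b is −2/7, 13/7, 3/7 on the vertices.
width-attained ε ε>0 = (1ℚ , 1ℚ) , a+b∈Λ* , (λ { (() , _) }) , +-monoʳ-< (+ 15 / 7) ε>0

7T-lattice : LatticeTri (scaleTri (+ 7 / 1) T)
7T-lattice =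
  ((-[1+ 7 ] , refl) , (+ 4 , refl) , (-[1+ 1 ] , refl)) ,
  ((+ 17 , refl) , (+ 9 , refl) , (+ 13 , refl)) ,
  ((+ 12 , refl) , (-[1+ 5 ] , refl) , (+ 3 , refl))

lemma4p1 : Hollow T × IsLatticeWidth T (+ 15 / 7) × LatticeTri (scaleTri (+ 7 / 1) T)
lemma4p1 = hollow , (width-lower-bound , width-attained) , 7T-lattice
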